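{- (B-Type Lemma.) Let $0\le k\le n$. Then $\nu^+_k-\nu^-_k=(2n-3k)I-\sigma_k$, where $I$ denotes the identity map on $M^n_k$.
   Context: Let $\mathbb F$ be a field. Let $V=\{\alpha_1,\bar\alpha_1,\dots,\alpha_n,\bar\alpha_n\}$ be a set of $2n$ distinct elements, with $\bar{\bar\alpha}_i=\alpha_i$. For $0\le k\le n$, $L^n_k$ is the set of $k$-element subsets $x\subseteq V$ with $|x\cap\{\alpha_i,\bar\alpha_i\}|\le1$ for all $i$; $M^n_k$ is the $\mathbb F$-vector space with basis $L^n_k$ ($M^n_k=0$ if $k<0$ or $k>n$). Linear maps are given on $x\in L^n_k$ by $\epsilon_k(x)=\sum_{y\in L^n_{k+1},\,y\supset x}y\in M^n_{k+1}$, $\partial_k(x)=\sum_{z\in L^n_{k-1},\,z\subset x}z\in M^n_{k-1}$, and $\sigma_k(x)=\sum_{\gamma\in x}(x\setminus\{\gamma\})\cup\{\bar\gamma\}\in M^n_k$. Put $\nu^+_k=\partial_{k+1}\epsilon_k$ and $\nu^-_k=\epsilon_{k-1}\partial_k$, maps $M^n_k\to M^n_k$. -}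

module Defs where

open import Level using (Level; suc; _⊔_)
open import Algebra.Bundles using (CommutativeRing)
open import Data.Nat as ℕ using (ℕ; zero; _≡ᵇ_)
open import Data.Bool using (Bool; true; false; not; _∧_; if_then_else_)
open import Data.Maybe using (Maybe; nothing; just)
open import Data.Vec using (Vec; []; _∷_)
open import Data.List using (List; []; _∷_; _++_; map; concatMap; filter; cartesianProductWith)
open import Data.Product using (_×_; _,_; proj₁; proj₂; ∃)
open import Relation.Nullary using (¬_; does)
open import Relation.Nullary.Decidable using (⌊_⌋)
open import Relation.Binary.PropositionalEquality using (_≡_)
import Data.Vec.Properties as VecP
import Data.Maybe.Properties as MaybeP
import Data.Bool.Properties as BoolP
open import Data.List.Relation.Unary.All using (All)

record Field (c ℓ : Level) : Set (suc (c ⊔ ℓ)) where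
  field
    commutativeRing : CommutativeRing c ℓ
  open CommutativeRing commutativeRing public
  field
    0≉1     : ¬ (0# ≈ 1#)
    inverse : ∀ x → ¬ (x ≈ 0#) → ∃ λ y → x * y ≈ 1#

-- An element of V = {α₁, ᾱ₁, …, αₙ, ᾱₙ} is a pair (i , b) with b = false
-- meaning αᵢ and b = true meaning ᾱᵢ (so bar = not).
-- A subset x ⊆ V with |x ∩ {αᵢ, ᾱᵢ}| ≤ 1 for all i is encoded as a vector
-- Vec (Maybe Bool) n: entry i is nothing (neither αᵢ nor ᾱᵢ in x),
-- just false (αᵢ ∈ x) or just true (ᾱᵢ ∈ x).  Such an x lies in L^n_k iff
-- its weight (number of `just` entries = its cardinality) is k.

Sub : ℕ → Set
Sub n = Vec (Maybe Bool) n

weight : ∀ {n} → Sub n → ℕ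
weight []             = 0
weight (nothing ∷ xs) = weight xs
weight (just _  ∷ xs) = ℕ.suc (weight xs)

_⊆ᵇ_ : ∀ {n} → Sub n → Sub n → Bool
[]             ⊆ᵇ []       = true
(nothing ∷ xs) ⊆ᵇ (_ ∷ ys) = xs ⊆ᵇ ys
(just a ∷ xs)  ⊆ᵇ (b ∷ ys) = ⌊ MaybeP.≡-dec BoolP._≟_ (just a) b ⌋ ∧ (xs ⊆ᵇ ys)

_≟ˢ_ : ∀ {n} (x y : Sub n) → _
_≟ˢ_ = VecP.≡-dec (MaybeP.≡-dec BoolP._≟_)

allSub : ∀ n → List (Sub n)
allSub zero        = [] ∷ []
allSub (ℕ.suc n)   =
  cartesianProductWith _∷_ (nothing ∷ just false ∷ just true ∷ []) (allSub n)

flips : ∀ {n} → Sub n → List (Sub n)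
flips []             = []
flips (nothing ∷ xs) = map (nothing ∷_) (flips xs)
flips (just b ∷ xs)  = (just (not b) ∷ xs) ∷ map (just b ∷_) (flips xs)

module Maps {c ℓ} (F : Field c ℓ) where
  open Field F

  Comb : ℕ → Set c
  Comb n = List (Carrier × Sub n)

  InM : ∀ n → ℕ → Comb n → Set c
  InM n k v = All (λ p → weight (proj₂ p) ≡ k) v

  coeff : ∀ {n} → Comb n → Sub n → Carrier
  coeff []            y = 0#
  coeff ((a , x) ∷ v) y = (if does (x ≟ˢ y) then a else 0#) + coeff v y

  _≋_ : ∀ {n} → Comb n → Comb n → Set ℓ
  v ≋ w = ∀ y → coeff v y ≈ coeff w y

  basis : ∀ {n} → List (Sub n) → Comb n
  basis = map (λ x → (1# , x))

  scale : ∀ {n} → Carrier → Comb n → Comb n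
  scale a = map (λ p → (a * proj₁ p , proj₂ p))

  _⊕_ : ∀ {n} → Comb n → Comb n → Comb n
  v ⊕ w = v ++ w

  _⊖_ : ∀ {n} → Comb n → Comb n → Comb n
  v ⊖ w = v ++ scale (- 1#) w

  lin : ∀ {n} → (Sub n → Comb n) → Comb n → Comb n
  lin f = concatMap (λ p → scale (proj₁ p) (f (proj₂ p)))

  ⟦_⟧ : ℕ → Carrier
  ⟦ zero ⟧    = 0#
  ⟦ ℕ.suc m ⟧ = 1# + ⟦ m ⟧

  ε : ∀ {n} → ℕ → Sub n → Comb n
  ε {n} k x = basis (filter (λ y → T? ((weight y ≡ᵇ ℕ.suc k) ∧ (x ⊆ᵇ y))) (allSub n))
    where open import Data.Bool using (T?)

  ∂ : ∀ {n} → ℕ → Sub n → Comb n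
  ∂ {n} k x = basis (filter (λ z → T? ((ℕ.suc (weight z) ≡ᵇ k) ∧ (z ⊆ᵇ x))) (allSub n))
    where open import Data.Bool using (T?)

  σ : ∀ {n} → Sub n → Comb n
  σ x = basis (flips x)

  ν⁺ : ∀ {n} → ℕ → Comb n → Comb n
  ν⁺ k v = lin (∂ (ℕ.suc k)) (lin (ε k) v)

  ν⁻ : ∀ {n} → ℕ → Comb n → Comb n
  ν⁻ k v = lin (ε (k ℕ.∸ 1)) (lin (∂ k) v)

-- By linearity it suffices to compare coefficients of a basis element y in the images of a
-- basis element x of weight k.  That coefficient is, in ν⁺ x, the number of common supersets
-- of x and y of weight k + 1; in ν⁻ x, the number of their common subsets of weight k − 1;
-- in σ x, 1 exactly when y is x with one element replaced by its bar.  For y = x these are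
-- 2(n − k), k and 0; if y arises from x by exchanging one element for one of another pair,
-- they are 1, 1 and 0; if y is x with one element barred, 0, 1 and 1; otherwise all vanish.
-- This identity of counts is proved by induction on n, splitting each count according to the
-- first entry of the set being counted.

module Submission where

open import Defs
open import Data.Nat as ℕ using (ℕ; _≤_)
import Relation.Binary.PropositionalEquality as ≡

module Counting where

  open import Data.Bool using (Bool; true; false; T; T?; _∧_; if_then_else_)
  open import Data.Bool.Properties using (∧-assoc; ∧-comm; ∧-identityʳ; ∧-zeroʳ)
  import Data.Bool.Properties as BoolP
  open import Data.Empty using (⊥-elim)
  open import Data.List using (List; []; _∷_; _++_; map; filter)
  open import Data.List.Properties using (map-++; map-∘; ++-identityʳ)
  open import Data.List.Relation.Unary.All as All using (All; []; _∷_)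
  open import Data.List.Relation.Unary.All.Properties using (map⁺)
  open import Data.Maybe using (Maybe; nothing; just)
  import Data.Maybe.Properties as MaybeP
  open import Data.Nat using (zero; suc; _+_; _*_; _∸_; _≡ᵇ_; z≤n; s≤s)
  open import Data.Nat.ListAction using (sum)
  open import Data.Nat.ListAction.Properties using (sum-++)
  open import Data.Nat.Properties using (+-identityʳ; ≡ᵇ⇒≡; m≤n⇒m≤1+n; suc-injective; 1+n≰n)
  open import Data.Nat.Tactic.RingSolver using (solve-∀)
  open import Data.Product using (_×_; _,_)
  open import Data.Unit using (tt)
  open import Data.Vec using ([]; _∷_)
  open import Data.Vec.Properties using (∷-injectiveʳ)
  open import Function using (_∘_)
  open import Relation.Nullary using (does; yes; no)
  open import Relation.Nullary.Decidable using (dec-true; dec-false)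
  open import Relation.Binary.PropositionalEquality hiding ([_])

  [_] : Bool → ℕ
  [ b ] = if b then 1 else 0

  count : ∀ {n} → (Sub n → Bool) → ℕ
  count {zero}  p = [ p [] ]
  count {suc n} p =
    count (λ z → p (nothing ∷ z)) + (count (λ z → p (just false ∷ z)) + count (λ z → p (just true ∷ z)))

  count-cong : ∀ {n} {p q : Sub n → Bool} → (∀ z → p z ≡ q z) → count p ≡ count q
  count-cong {zero}  p≗q = cong [_] (p≗q [])
  count-cong {suc n} p≗q =
    cong₂ _+_ (count-cong (λ z → p≗q (nothing ∷ z)))
              (cong₂ _+_ (count-cong (λ z → p≗q (just false ∷ z))) (count-cong (λ z → p≗q (just true ∷ z))))

  count-false : ∀ {n} → count {n} (λ _ → false) ≡ 0
  count-false {zero}  = refl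
  count-false {suc n} rewrite count-false {n} = refl

  count-none : ∀ {n} {p : Sub n → Bool} → (∀ z → p z ≡ false) → count p ≡ 0
  count-none {n} p≗false = trans (count-cong p≗false) (count-false {n})

  elsewhere-false : ∀ {n} {p : Sub n → Bool} {y z} → (∀ w → T (p w) → w ≡ y) → z ≢ y → p z ≡ false
  elsewhere-false {p = p} {z = z} only-y z≢y with p z | only-y z
  ... | false | _    = refl
  ... | true  | z≡y  = ⊥-elim (z≢y (z≡y tt))

  count-unique : ∀ {n} {p : Sub n → Bool} {y} → (∀ z → T (p z) → z ≡ y) → count p ≡ [ p y ]
  count-unique {y = []} _ = refl
  count-unique {p = p} {nothing ∷ y} only-y
    rewrite count-unique {p = λ z → p (nothing ∷ z)} {y} (λ z pz → ∷-injectiveʳ (only-y _ pz))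
          | count-none {p = λ z → p (just false ∷ z)} (λ z → elsewhere-false only-y λ ())
          | count-none {p = λ z → p (just true ∷ z)} (λ z → elsewhere-false only-y λ ()) = +-identityʳ _
  count-unique {p = p} {just false ∷ y} only-y
    rewrite count-none {p = λ z → p (nothing ∷ z)} (λ z → elsewhere-false only-y λ ())
          | count-unique {p = λ z → p (just false ∷ z)} {y} (λ z pz → ∷-injectiveʳ (only-y _ pz))
          | count-none {p = λ z → p (just true ∷ z)} (λ z → elsewhere-false only-y λ ()) = +-identityʳ _
  count-unique {p = p} {just true ∷ y} only-y
    rewrite count-none {p = λ z → p (nothing ∷ z)} (λ z → elsewhere-false only-y λ ())
          | count-none {p = λ z → p (just false ∷ z)} (λ z → elsewhere-false only-y λ ())
          | count-unique {p = λ z → p (just true ∷ z)} {y} (λ z pz → ∷-injectiveʳ (only-y _ pz)) = refl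

  count-∧false : ∀ {n} (p : Sub n → Bool) → count (λ z → p z ∧ false) ≡ 0
  count-∧false p = count-none (λ z → ∧-zeroʳ (p z))

  ⊆ᵇ-refl : ∀ {n} (x : Sub n) → (x ⊆ᵇ x) ≡ true
  ⊆ᵇ-refl []               = refl
  ⊆ᵇ-refl (nothing ∷ x)    = ⊆ᵇ-refl x
  ⊆ᵇ-refl (just false ∷ x) = ⊆ᵇ-refl x
  ⊆ᵇ-refl (just true ∷ x)  = ⊆ᵇ-refl x

  ⊆ᵇ⇒weight-≤ : ∀ {n} {x z : Sub n} → T (x ⊆ᵇ z) → weight x ≤ weight z
  ⊆ᵇ⇒weight-≤ {x = []}              {[]}              _   = z≤n
  ⊆ᵇ⇒weight-≤ {x = nothing ∷ x}     {nothing ∷ z}     x⊆z = ⊆ᵇ⇒weight-≤ {x = x} x⊆z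
  ⊆ᵇ⇒weight-≤ {x = nothing ∷ x}     {just _ ∷ z}      x⊆z = m≤n⇒m≤1+n (⊆ᵇ⇒weight-≤ {x = x} x⊆z)
  ⊆ᵇ⇒weight-≤ {x = just false ∷ x}  {just false ∷ z}  x⊆z = s≤s (⊆ᵇ⇒weight-≤ {x = x} x⊆z)
  ⊆ᵇ⇒weight-≤ {x = just true ∷ x}   {just true ∷ z}   x⊆z = s≤s (⊆ᵇ⇒weight-≤ {x = x} x⊆z)

  ⊆ᵇ-weight-≡⇒≡ : ∀ {n} {x z : Sub n} → T (x ⊆ᵇ z) → weight x ≡ weight z → x ≡ z
  ⊆ᵇ-weight-≡⇒≡ {x = []}             {[]}             _   _ = refl
  ⊆ᵇ-weight-≡⇒≡ {x = nothing ∷ x}    {nothing ∷ z}    x⊆z w = cong (nothing ∷_) (⊆ᵇ-weight-≡⇒≡ x⊆z w)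
  ⊆ᵇ-weight-≡⇒≡ {x = nothing ∷ x}    {just _ ∷ z}     x⊆z w =
    ⊥-elim (1+n≰n (subst (_≤ weight z) w (⊆ᵇ⇒weight-≤ {x = x} x⊆z)))
  ⊆ᵇ-weight-≡⇒≡ {x = just false ∷ x} {just false ∷ z} x⊆z w = cong (just false ∷_) (⊆ᵇ-weight-≡⇒≡ x⊆z (suc-injective w))
  ⊆ᵇ-weight-≡⇒≡ {x = just true ∷ x}  {just true ∷ z}  x⊆z w = cong (just true ∷_) (⊆ᵇ-weight-≡⇒≡ x⊆z (suc-injective w))

  ≡ᵇ-refl : ∀ m → (m ≡ᵇ m) ≡ true
  ≡ᵇ-refl m = dec-true (m ℕ.≟ m) refl

  ≡ᵇ-≢ : ∀ {m n} → m ≢ n → (m ≡ᵇ n) ≡ false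
  ≡ᵇ-≢ {m} {n} = dec-false (m ℕ.≟ n)

  ∧-swap : ∀ a b c → a ∧ b ∧ c ≡ b ∧ a ∧ c
  ∧-swap a b c = trans (sym (∧-assoc a b c)) (trans (cong (_∧ c) (∧-comm a b)) (∧-assoc b a c))

  ∧-rotate : ∀ a b c → (a ∧ b) ∧ c ≡ b ∧ c ∧ a
  ∧-rotate true  b c = cong (b ∧_) (sym (∧-identityʳ c))
  ∧-rotate false b c = sym (trans (cong (b ∧_) (∧-zeroʳ c)) (∧-zeroʳ b))

  T-∧³ : ∀ {a b c} → T (a ∧ b ∧ c) → T a × T b × T c
  T-∧³ {true} {true} {true} _ = tt , tt , tt

  commonSupersets : ∀ {n} → ℕ → Sub n → Sub n → ℕ
  commonSupersets m x y = count (λ z → (x ⊆ᵇ z) ∧ (y ⊆ᵇ z) ∧ (weight z ≡ᵇ m))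

  -- Common subsets of weight m − 1; there are none for m = 0.
  commonSubsets : ∀ {n} → ℕ → Sub n → Sub n → ℕ
  commonSubsets m x y = count (λ z → (z ⊆ᵇ x) ∧ (z ⊆ᵇ y) ∧ (suc (weight z) ≡ᵇ m))

  commonSupersets-comm : ∀ {n} m (x y : Sub n) → commonSupersets m x y ≡ commonSupersets m y x
  commonSupersets-comm m x y = count-cong λ z → ∧-swap (x ⊆ᵇ z) (y ⊆ᵇ z) _

  commonSubsets-comm : ∀ {n} m (x y : Sub n) → commonSubsets m x y ≡ commonSubsets m y x
  commonSubsets-comm m x y = count-cong λ z → ∧-swap (z ⊆ᵇ x) (z ⊆ᵇ y) _

  commonSupersets-selfˡ : ∀ {n} (x y : Sub n) → commonSupersets (weight x) x y ≡ [ y ⊆ᵇ x ]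
  commonSupersets-selfˡ x y = trans (count-unique only-x) (cong [_] at-x)
    where
    only-x : ∀ z → T ((x ⊆ᵇ z) ∧ (y ⊆ᵇ z) ∧ (weight z ≡ᵇ weight x)) → z ≡ x
    only-x z p = let x⊆z , _ , w = T-∧³ p in sym (⊆ᵇ-weight-≡⇒≡ x⊆z (sym (≡ᵇ⇒≡ _ _ w)))
    at-x : (x ⊆ᵇ x) ∧ (y ⊆ᵇ x) ∧ (weight x ≡ᵇ weight x) ≡ y ⊆ᵇ x
    at-x rewrite ⊆ᵇ-refl x | ≡ᵇ-refl (weight x) = ∧-identityʳ _

  commonSubsets-selfʳ : ∀ {n} (x y : Sub n) → commonSubsets (suc (weight y)) x y ≡ [ y ⊆ᵇ x ]
  commonSubsets-selfʳ x y = trans (count-unique only-y) (cong [_] at-y)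
    where
    only-y : ∀ z → T ((z ⊆ᵇ x) ∧ (z ⊆ᵇ y) ∧ (weight z ≡ᵇ weight y)) → z ≡ y
    only-y z p = let _ , z⊆y , w = T-∧³ {z ⊆ᵇ x} p in ⊆ᵇ-weight-≡⇒≡ z⊆y (≡ᵇ⇒≡ _ _ w)
    at-y : (y ⊆ᵇ x) ∧ (y ⊆ᵇ y) ∧ (weight y ≡ᵇ weight y) ≡ y ⊆ᵇ x
    at-y rewrite ⊆ᵇ-refl y | ≡ᵇ-refl (weight y) = ∧-identityʳ _

  commonSupersets-selfʳ : ∀ {n} (x y : Sub n) → commonSupersets (weight y) x y ≡ [ x ⊆ᵇ y ]
  commonSupersets-selfʳ x y = trans (commonSupersets-comm (weight y) x y) (commonSupersets-selfˡ y x)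

  commonSubsets-selfˡ : ∀ {n} (x y : Sub n) → commonSubsets (suc (weight x)) x y ≡ [ x ⊆ᵇ y ]
  commonSubsets-selfˡ x y = trans (commonSubsets-comm (suc (weight x)) x y) (commonSubsets-selfʳ y x)

  δ : ∀ {n} → Sub n → Sub n → ℕ
  δ x y = [ does (x ≟ˢ y) ]

  δ-≢ : ∀ {n} {x y : Sub n} → x ≢ y → δ x y ≡ 0
  δ-≢ {x = x} {y} x≢y = cong [_] (dec-false (x ≟ˢ y) x≢y)

  multiplicity : ∀ {n} → Sub n → List (Sub n) → ℕ
  multiplicity y L = sum (map (λ z → δ z y) L)

  _≟ʰ_ : (a b : Maybe Bool) → _
  _≟ʰ_ = MaybeP.≡-dec BoolP._≟_

  multiplicity-map-∷ : ∀ {n} (a b : Maybe Bool) (y : Sub n) L →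
    multiplicity (b ∷ y) (map (a ∷_) L) ≡ (if does (a ≟ʰ b) then multiplicity y L else 0)
  multiplicity-map-∷ a b y [] with does (a ≟ʰ b)
  ... | true  = refl
  ... | false = refl
  multiplicity-map-∷ a b y (z ∷ L) rewrite multiplicity-map-∷ a b y L with does (a ≟ʰ b)
  ... | true  = refl
  ... | false = refl

  [⊇ᵇ]≡δ : ∀ {n} {x y : Sub n} → weight x ≡ weight y → [ y ⊆ᵇ x ] ≡ δ x y
  [⊇ᵇ]≡δ {x = x} {y} w with x ≟ˢ y | y ⊆ᵇ x in y⊆x
  ... | yes refl | _     = cong [_] (trans (sym y⊆x) (⊆ᵇ-refl x))
  ... | no  _    | false = refl
  ... | no  x≢y  | true  = ⊥-elim (x≢y (sym (⊆ᵇ-weight-≡⇒≡ (subst T (sym y⊆x) tt) (sym w))))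

  [⊆ᵇ]≡δ : ∀ {n} {x y : Sub n} → weight x ≡ weight y → [ x ⊆ᵇ y ] ≡ δ x y
  [⊆ᵇ]≡δ {x = x} {y} w with x ≟ˢ y | x ⊆ᵇ y in x⊆y
  ... | yes refl | _     = cong [_] (trans (sym x⊆y) (⊆ᵇ-refl x))
  ... | no  _    | false = refl
  ... | no  x≢y  | true  = ⊥-elim (x≢y (⊆ᵇ-weight-≡⇒≡ (subst T (sym x⊆y) tt) w))

  sum-map-++ : ∀ {A : Set} (f : A → ℕ) xs ys → sum (map f (xs ++ ys)) ≡ sum (map f xs) + sum (map f ys)
  sum-map-++ f xs ys = trans (cong sum (map-++ f xs ys)) (sum-++ (map f xs) (map f ys))

  sum-map-∘ : ∀ {A B : Set} (f : B → ℕ) (g : A → B) xs → sum (map f (map g xs)) ≡ sum (map (λ x → f (g x)) xs)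
  sum-map-∘ f g xs = cong sum (sym (map-∘ xs))

  sum-allSub-suc : ∀ {n} (f : Sub (suc n) → ℕ) →
    sum (map f (allSub (suc n)))
      ≡ sum (map (λ z → f (nothing ∷ z)) (allSub n))
        + (sum (map (λ z → f (just false ∷ z)) (allSub n)) + sum (map (λ z → f (just true ∷ z)) (allSub n)))
  sum-allSub-suc {n} f = begin
    sum (map f (N ++ (J₀ ++ (J₁ ++ []))))                     ≡⟨ sum-map-++ f N _ ⟩
    sum (map f N) + sum (map f (J₀ ++ (J₁ ++ [])))             ≡⟨ cong (sum (map f N) +_) (sum-map-++ f J₀ _) ⟩
    sum (map f N) + (sum (map f J₀) + sum (map f (J₁ ++ [])))  ≡⟨ cong₂ _+_ (sum-map-∘ f _ L)
                                                                    (cong₂ _+_ (sum-map-∘ f _ L)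
                                                                      (trans (cong (sum ∘ map f) (++-identityʳ J₁)) (sum-map-∘ f _ L))) ⟩
    _                                                           ∎
    where
    open ≡-Reasoning
    L = allSub n
    N = map (nothing ∷_) L
    J₀ = map (just false ∷_) L
    J₁ = map (just true ∷_) L

  sum-allSub : ∀ {n} (p : Sub n → Bool) → sum (map (λ z → [ p z ]) (allSub n)) ≡ count p
  sum-allSub {zero}  p = +-identityʳ _
  sum-allSub {suc n} p = trans (sum-allSub-suc (λ z → [ p z ]))
    (cong₂ _+_ (sum-allSub (λ z → p (nothing ∷ z)))
      (cong₂ _+_ (sum-allSub (λ z → p (just false ∷ z))) (sum-allSub (λ z → p (just true ∷ z)))))

  sum-filter : ∀ {n} (p q : Sub n → Bool) L →
    sum (map (λ z → [ q z ]) (filter (λ z → T? (p z)) L)) ≡ sum (map (λ z → [ p z ∧ q z ]) L)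
  sum-filter p q [] = refl
  sum-filter p q (z ∷ L) with p z
  ... | true  = cong ([ q z ] +_) (sum-filter p q L)
  ... | false = sum-filter p q L

  count-filter-allSub : ∀ {n} (p q : Sub n → Bool) →
    sum (map (λ z → [ q z ]) (filter (λ z → T? (p z)) (allSub n))) ≡ count (λ z → p z ∧ q z)
  count-filter-allSub {n} p q = trans (sum-filter p q (allSub n)) (sum-allSub (λ z → p z ∧ q z))

  multiplicity-filter-allSub : ∀ {n} (p : Sub n → Bool) (y : Sub n) →
    multiplicity y (filter (λ z → T? (p z)) (allSub n)) ≡ [ p y ]
  multiplicity-filter-allSub p y =
    trans (count-filter-allSub p (λ z → does (z ≟ˢ y)))
      (trans (count-unique only-y) (cong [_] (trans (cong (p y ∧_) (dec-true (y ≟ˢ y) refl)) (∧-identityʳ (p y)))))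
    where
    only-y : ∀ z → T (p z ∧ does (z ≟ˢ y)) → z ≡ y
    only-y z t with p z | z ≟ˢ y
    ... | true | yes z≡y = z≡y

  flips-weight : ∀ {n} (x : Sub n) → All (λ z → weight z ≡ weight x) (flips x)
  flips-weight []             = []
  flips-weight (nothing ∷ x)  = map⁺ (flips-weight x)
  flips-weight (just b ∷ x)   = refl ∷ map⁺ (All.map (cong suc) (flips-weight x))

  multiplicity-absent : ∀ {n} {y : Sub n} {L} → All (_≢ y) L → multiplicity y L ≡ 0
  multiplicity-absent []            = refl
  multiplicity-absent (z≢y ∷ L≢y)   rewrite δ-≢ z≢y = multiplicity-absent L≢y

  multiplicity-flips-≢ : ∀ {n} {x y : Sub n} → weight x ≢ weight y → multiplicity y (flips x) ≡ 0
  multiplicity-flips-≢ {x = x} wx≢wy =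
    multiplicity-absent (All.map (λ { wz≡wx refl → wx≢wy (sym wz≡wx) }) (flips-weight x))

  Balanced : ∀ {n} → Sub n → Sub n → Set
  Balanced {n} x y = commonSupersets (suc (weight x)) x y + δ x y * (3 * weight x) + multiplicity y (flips x)
                       ≡ commonSubsets (weight x) x y + δ x y * (2 * n)

  -- The two steps are stated in the shape the goals of balanced take once their pieces are
  -- evaluated, hence the stray + 0.
  free-position-step : ∀ {n} (x y : Sub n) → Balanced x y →
    let S = commonSupersets (suc (weight x)) x y; D = commonSubsets (weight x) x y
        F = multiplicity y (flips x); d = δ x y; k = weight x
    in S + (d + d) + d * (3 * k) + F ≡ D + 0 + d * (2 * suc n)
  free-position-step {n} x y tail-balanced = begin
    S + (d + d) + d * (3 * k) + F   ≡⟨ regroup S d k F ⟩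
    (S + d * (3 * k) + F) + 2 * d   ≡⟨ cong (_+ 2 * d) tail-balanced ⟩
    (D + d * (2 * n)) + 2 * d       ≡⟨ collect D n d ⟩
    D + 0 + d * (2 * suc n)         ∎
    where
    open ≡-Reasoning
    S = commonSupersets (suc (weight x)) x y
    D = commonSubsets (weight x) x y
    F = multiplicity y (flips x)
    d = δ x y
    k = weight x
    regroup : ∀ S d k F → S + (d + d) + d * (3 * k) + F ≡ (S + d * (3 * k) + F) + 2 * d
    regroup = solve-∀
    collect : ∀ D n d → (D + d * (2 * n)) + 2 * d ≡ D + 0 + d * (2 * suc n)
    collect = solve-∀

  common-position-step : ∀ {n} (x y : Sub n) → Balanced x y →
    let S = commonSupersets (suc (weight x)) x y; D = commonSubsets (weight x) x y
        F = multiplicity y (flips x); d = δ x y; k = weight x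
    in S + d * (3 * suc k) + F ≡ d + D + d * (2 * suc n)
  common-position-step {n} x y tail-balanced = begin
    S + d * (3 * suc k) + F         ≡⟨ regroup S d k F ⟩
    (S + d * (3 * k) + F) + 3 * d   ≡⟨ cong (_+ 3 * d) tail-balanced ⟩
    (D + d * (2 * n)) + 3 * d       ≡⟨ collect D n d ⟩
    d + D + d * (2 * suc n)         ∎
    where
    open ≡-Reasoning
    S = commonSupersets (suc (weight x)) x y
    D = commonSubsets (weight x) x y
    F = multiplicity y (flips x)
    d = δ x y
    k = weight x
    regroup : ∀ S d k F → S + d * (3 * suc k) + F ≡ (S + d * (3 * k) + F) + 3 * d
    regroup = solve-∀
    collect : ∀ D n d → (D + d * (2 * n)) + 3 * d ≡ d + D + d * (2 * suc n)
    collect = solve-∀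

  -- Each count splits by the first entry of z: pieces where that entry is incompatible with
  -- x or y vanish, and a piece pinned to the weight of x (or y) counts only x (or y) itself.
  balanced : ∀ {n} (x y : Sub n) → weight x ≡ weight y → Balanced x y
  balanced [] [] _ = refl
  balanced {suc n} (nothing ∷ x) (nothing ∷ y) w
    rewrite multiplicity-map-∷ nothing nothing y (flips x) | count-false {n}
          | commonSupersets-selfˡ x y | [⊇ᵇ]≡δ {x = x} {y} w
    = free-position-step x y (balanced x y w)
  balanced {suc n} (nothing ∷ x) (just false ∷ y) w
    rewrite multiplicity-map-∷ nothing (just false) y (flips x) | count-false {n} | count-∧false (x ⊆ᵇ_)
          | commonSupersets-selfˡ x y | w | commonSubsets-selfʳ x y
    = +-identityʳ _
  balanced {suc n} (nothing ∷ x) (just true ∷ y) w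
    rewrite multiplicity-map-∷ nothing (just true) y (flips x) | count-false {n} | count-∧false (x ⊆ᵇ_)
          | commonSupersets-selfˡ x y | w | commonSubsets-selfʳ x y
    = refl
  balanced {suc n} (just false ∷ x) (nothing ∷ y) w
    rewrite multiplicity-map-∷ (just false) nothing y (flips x) | count-false {n} | count-∧false (_⊆ᵇ x)
          | commonSubsets-selfˡ x y | w | commonSupersets-selfʳ x y
    = +-identityʳ _
  balanced {suc n} (just true ∷ x) (nothing ∷ y) w
    rewrite multiplicity-map-∷ (just true) nothing y (flips x) | count-false {n} | count-∧false (_⊆ᵇ x)
          | commonSubsets-selfˡ x y | w | commonSupersets-selfʳ x y
    = refl
  balanced {suc n} (just false ∷ x) (just false ∷ y) w
    rewrite multiplicity-map-∷ (just false) (just false) y (flips x) | count-false {n}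
          | +-identityʳ (commonSupersets (suc (weight x)) x y) | +-identityʳ (commonSubsets (weight x) x y)
          | commonSubsets-selfˡ x y | [⊆ᵇ]≡δ {x = x} {y} (suc-injective w)
    = common-position-step x y (balanced x y (suc-injective w))
  balanced {suc n} (just true ∷ x) (just true ∷ y) w
    rewrite multiplicity-map-∷ (just true) (just true) y (flips x) | count-false {n}
          | commonSubsets-selfˡ x y | [⊆ᵇ]≡δ {x = x} {y} (suc-injective w)
    = common-position-step x y (balanced x y (suc-injective w))
  balanced {suc n} (just false ∷ x) (just true ∷ y) w
    rewrite multiplicity-map-∷ (just false) (just true) y (flips x) | count-false {n}
          | count-∧false (x ⊆ᵇ_) | count-∧false (_⊆ᵇ x)
          | commonSubsets-selfˡ x y | [⊆ᵇ]≡δ {x = x} {y} (suc-injective w)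
    = sym (+-identityʳ _)
  balanced {suc n} (just true ∷ x) (just false ∷ y) w
    rewrite multiplicity-map-∷ (just true) (just false) y (flips x) | count-false {n}
          | count-∧false (x ⊆ᵇ_) | count-∧false (_⊆ᵇ x)
          | commonSubsets-selfˡ x y | [⊆ᵇ]≡δ {x = x} {y} (suc-injective w)
    = sym (+-identityʳ _)

  -- The coefficient of y in ν⁺ x and in ν⁻ x, counted through the intermediate subset z.
  ν⁺-count : ∀ {n} → Sub n → Sub n → ℕ
  ν⁺-count x y = count (λ z → ((weight z ≡ᵇ suc (weight x)) ∧ (x ⊆ᵇ z)) ∧ ((weight y ≡ᵇ weight x) ∧ (y ⊆ᵇ z)))

  ν⁻-count : ∀ {n} → Sub n → Sub n → ℕ
  ν⁻-count x y = count (λ z → ((suc (weight z) ≡ᵇ weight x) ∧ (z ⊆ᵇ x)) ∧ ((weight y ≡ᵇ suc (weight x ∸ 1)) ∧ (z ⊆ᵇ y)))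

  ν⁺-count-same-weight : ∀ {n} {x y : Sub n} → weight y ≡ weight x → ν⁺-count x y ≡ commonSupersets (suc (weight x)) x y
  ν⁺-count-same-weight {x = x} {y} w rewrite w | ≡ᵇ-refl (weight x) =
    count-cong (λ z → ∧-rotate (weight z ≡ᵇ suc (weight x)) (x ⊆ᵇ z) (y ⊆ᵇ z))

  ν⁻-count-same-weight : ∀ {n} {x y : Sub n} → weight y ≡ weight x → ν⁻-count x y ≡ commonSubsets (weight x) x y
  ν⁻-count-same-weight {n} {x} {y} w with weight x | w
  ... | zero  | _    = trans (count-false {n}) (sym (count-none (λ z → sym (∧-rotate false (z ⊆ᵇ x) (z ⊆ᵇ y)))))
  ... | suc m | w′ rewrite w′ | ≡ᵇ-refl m = count-cong (λ z → ∧-rotate (weight z ≡ᵇ m) (z ⊆ᵇ x) (z ⊆ᵇ y))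

  ν⁺-count-≢ : ∀ {n} {x y : Sub n} → weight y ≢ weight x → ν⁺-count x y ≡ 0
  ν⁺-count-≢ {x = x} {y} w rewrite ≡ᵇ-≢ w = count-∧false (λ z → (weight z ≡ᵇ suc (weight x)) ∧ (x ⊆ᵇ z))

  ν⁻-count-≢ : ∀ {n} {x y : Sub n} → weight y ≢ weight x → ν⁻-count x y ≡ 0
  ν⁻-count-≢ {n} {x} {y} w with weight x | w
  ... | zero  | _ = count-false {n}
  ... | suc m | w′ rewrite ≡ᵇ-≢ w′ = count-∧false (λ z → (weight z ≡ᵇ m) ∧ (z ⊆ᵇ x))

  ν-counts-balanced : ∀ {n} (x y : Sub n) →
    ν⁺-count x y + δ x y * (3 * weight x) + multiplicity y (flips x) ≡ ν⁻-count x y + δ x y * (2 * n)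
  ν-counts-balanced x y with weight y ℕ.≟ weight x
  ... | yes w rewrite ν⁺-count-same-weight {x = x} {y} w | ν⁻-count-same-weight {x = x} {y} w = balanced x y (sym w)
  ... | no w rewrite ν⁺-count-≢ {x = x} {y} w | ν⁻-count-≢ {x = x} {y} w | δ-≢ {x = x} {y} (λ { refl → w refl })
                   | multiplicity-flips-≢ {x = x} {y} (λ wx≡wy → w (sym wx≡wy)) = refl

module Coefficients {c ℓ} (F : Field c ℓ) where

  open import Data.Bool using (Bool; true; false; T?; _∧_; if_then_else_)
  open import Data.List using (List; []; _∷_; _++_; map; filter)
  open import Data.List.Relation.Unary.All using ([]; _∷_)
  open import Data.Maybe using (nothing)
  open import Data.Nat using (suc)
  open import Data.Nat.ListAction using (sum)
  open import Data.Product using (_,_)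
  open import Relation.Nullary using (does)
  open Counting using ([_]; count; δ; multiplicity; multiplicity-filter-allSub; count-filter-allSub;
                      ν⁺-count; ν⁻-count; ν-counts-balanced)
  open Field F
  open Maps F
  open import Relation.Binary.Reasoning.Setoid setoid
  open import Algebra.Properties.Ring ring using (-1*x≈-x; -‿distribʳ-*)
  open import Algebra.Properties.AbelianGroup +-abelianGroup
    using (⁻¹-∙-comm; x∙y⁻¹≈ε⇒x≈y; x≈y⇒x∙y⁻¹≈ε; ⁻¹-anti-homo‿-)
  open import Algebra.Properties.CommutativeSemigroup +-commutativeSemigroup using (interchange)
  open import Tactic.RingSolver.Core.AlmostCommutativeRing using (fromCommutativeRing)
  open import Tactic.RingSolver.NonReflective (fromCommutativeRing commutativeRing (λ _ → nothing))
    using (solve; _⊜_) renaming (_⊕_ to _:+_; _⊗_ to _:*_)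

  ⟦≡⟧ : ∀ {m n} → m ≡.≡ n → ⟦ m ⟧ ≈ ⟦ n ⟧
  ⟦≡⟧ ≡.refl = refl

  ⟦+⟧ : ∀ m n → ⟦ m ℕ.+ n ⟧ ≈ ⟦ m ⟧ + ⟦ n ⟧
  ⟦+⟧ ℕ.zero    n = sym (+-identityˡ _)
  ⟦+⟧ (ℕ.suc m) n = trans (+-congˡ (⟦+⟧ m n)) (sym (+-assoc _ _ _))

  ⟦*⟧ : ∀ m n → ⟦ m ℕ.* n ⟧ ≈ ⟦ m ⟧ * ⟦ n ⟧
  ⟦*⟧ ℕ.zero    n = sym (zeroˡ _)
  ⟦*⟧ (ℕ.suc m) n = begin
    ⟦ n ℕ.+ m ℕ.* n ⟧          ≈⟨ ⟦+⟧ n (m ℕ.* n) ⟩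
    ⟦ n ⟧ + ⟦ m ℕ.* n ⟧        ≈⟨ +-cong (sym (*-identityˡ _)) (⟦*⟧ m n) ⟩
    1# * ⟦ n ⟧ + ⟦ m ⟧ * ⟦ n ⟧ ≈⟨ sym (distribʳ _ _ _) ⟩
    (1# + ⟦ m ⟧) * ⟦ n ⟧       ∎

  *-distribˡ-minus : ∀ a p q → a * (p - q) ≈ a * p - a * q
  *-distribˡ-minus a p q = trans (distribˡ a p (- q)) (+-congˡ (sym (-‿distribʳ-* a q)))

  transpose : ∀ {a b c d} → a + b ≈ c + d → a - c ≈ d - b
  transpose {a} {b} {c} {d} a+b≈c+d = x∙y⁻¹≈ε⇒x≈y _ _ (begin
    (a - c) - (d - b)    ≈⟨ +-congˡ (⁻¹-anti-homo‿- d b) ⟩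
    (a - c) + (b - d)    ≈⟨ interchange a (- c) b (- d) ⟩
    (a + b) + (- c - d)  ≈⟨ +-congˡ (⁻¹-∙-comm c d) ⟩
    (a + b) - (c + d)    ≈⟨ x≈y⇒x∙y⁻¹≈ε a+b≈c+d ⟩
    0#                   ∎)

  ⟪_∣_⟫ : ∀ {n} → Comb n → (Sub n → Carrier) → Carrier
  ⟪ []          ∣ φ ⟫ = 0#
  ⟪ (a , x) ∷ v ∣ φ ⟫ = a * φ x + ⟪ v ∣ φ ⟫

  ⟦δ⟧ : ∀ {n} → Sub n → Sub n → Carrier
  ⟦δ⟧ y x = ⟦ δ x y ⟧

  coeff≈⟪⟦δ⟧⟫ : ∀ {n} (v : Comb n) y → coeff v y ≈ ⟪ v ∣ ⟦δ⟧ y ⟫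
  coeff≈⟪⟦δ⟧⟫ []            y = refl
  coeff≈⟪⟦δ⟧⟫ ((a , x) ∷ v) y = +-cong (selected (does (x ≟ˢ y))) (coeff≈⟪⟦δ⟧⟫ v y)
    where
    selected : ∀ b → (if b then a else 0#) ≈ a * ⟦ [ b ] ⟧
    selected true  = sym (trans (*-congˡ (+-identityʳ 1#)) (*-identityʳ a))
    selected false = sym (zeroʳ a)

  ⟪⟫-++ : ∀ {n} (v w : Comb n) φ → ⟪ v ++ w ∣ φ ⟫ ≈ ⟪ v ∣ φ ⟫ + ⟪ w ∣ φ ⟫
  ⟪⟫-++ []            w φ = sym (+-identityˡ _)
  ⟪⟫-++ ((a , x) ∷ v) w φ = trans (+-congˡ (⟪⟫-++ v w φ)) (sym (+-assoc _ _ _))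

  ⟪⟫-scale : ∀ {n} b (v : Comb n) φ → ⟪ scale b v ∣ φ ⟫ ≈ b * ⟪ v ∣ φ ⟫
  ⟪⟫-scale b []            φ = sym (zeroʳ b)
  ⟪⟫-scale b ((a , x) ∷ v) φ = trans (+-cong (*-assoc b a (φ x)) (⟪⟫-scale b v φ)) (sym (distribˡ b _ _))

  ⟪⟫-⊖ : ∀ {n} (v w : Comb n) φ → ⟪ v ⊖ w ∣ φ ⟫ ≈ ⟪ v ∣ φ ⟫ - ⟪ w ∣ φ ⟫
  ⟪⟫-⊖ v w φ = trans (⟪⟫-++ v (scale (- 1#) w) φ) (+-congˡ (trans (⟪⟫-scale (- 1#) w φ) (-1*x≈-x _)))

  ⟪⟫-lin : ∀ {n} (f : Sub n → Comb n) (v : Comb n) φ → ⟪ lin f v ∣ φ ⟫ ≈ ⟪ v ∣ (λ x → ⟪ f x ∣ φ ⟫) ⟫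
  ⟪⟫-lin f []            φ = refl
  ⟪⟫-lin f ((a , x) ∷ v) φ =
    trans (⟪⟫-++ (scale a (f x)) (lin f v) φ) (+-cong (⟪⟫-scale a (f x) φ) (⟪⟫-lin f v φ))

  ⟪⟫-lin² : ∀ {n} (g f : Sub n → Comb n) (v : Comb n) φ →
    ⟪ lin g (lin f v) ∣ φ ⟫ ≈ ⟪ v ∣ (λ x → ⟪ f x ∣ (λ z → ⟪ g z ∣ φ ⟫) ⟫) ⟫
  ⟪⟫-lin² g f v φ = trans (⟪⟫-lin g (lin f v) φ) (⟪⟫-lin f v _)

  ⟪⟫-*ˡ : ∀ {n} b (v : Comb n) φ → ⟪ v ∣ (λ x → b * φ x) ⟫ ≈ b * ⟪ v ∣ φ ⟫
  ⟪⟫-*ˡ b []            φ = sym (zeroʳ b)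
  ⟪⟫-*ˡ b ((a , x) ∷ v) φ = trans (+-congˡ (⟪⟫-*ˡ b v φ)) (swap a b (φ x) ⟪ v ∣ φ ⟫)
    where
    swap : ∀ a b p r → a * (b * p) + b * r ≈ b * (a * p + r)
    swap = solve 4 (λ a b p r → a :* (b :* p) :+ b :* r ⊜ (b :* (a :* p :+ r))) refl

  ⟪⟫-minus : ∀ {n} (v : Comb n) φ ψ → ⟪ v ∣ (λ x → φ x - ψ x) ⟫ ≈ ⟪ v ∣ φ ⟫ - ⟪ v ∣ ψ ⟫
  ⟪⟫-minus []            φ ψ = sym (-‿inverseʳ 0#)
  ⟪⟫-minus ((a , x) ∷ v) φ ψ = begin
    a * (φ x - ψ x) + ⟪ v ∣ (λ x → φ x - ψ x) ⟫        ≈⟨ +-cong (*-distribˡ-minus a (φ x) (ψ x)) (⟪⟫-minus v φ ψ) ⟩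
    (a * φ x - a * ψ x) + (⟪ v ∣ φ ⟫ - ⟪ v ∣ ψ ⟫)       ≈⟨ interchange _ _ _ _ ⟩
    (a * φ x + ⟪ v ∣ φ ⟫) + (- (a * ψ x) - ⟪ v ∣ ψ ⟫)  ≈⟨ +-congˡ (⁻¹-∙-comm _ _) ⟩
    (a * φ x + ⟪ v ∣ φ ⟫) - (a * ψ x + ⟪ v ∣ ψ ⟫)      ∎

  ⟪⟫-cong-InM : ∀ {n k} {v : Comb n} {φ ψ} → InM n k v → (∀ x → weight x ≡.≡ k → φ x ≈ ψ x) →
    ⟪ v ∣ φ ⟫ ≈ ⟪ v ∣ ψ ⟫
  ⟪⟫-cong-InM []         φ≈ψ = refl
  ⟪⟫-cong-InM (w ∷ v∈M) φ≈ψ = +-cong (*-congˡ (φ≈ψ _ w)) (⟪⟫-cong-InM v∈M φ≈ψ)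

  ⟪⟫-basis : ∀ {n} (L : List (Sub n)) {φ} (g : Sub n → ℕ) → (∀ x → φ x ≈ ⟦ g x ⟧) →
    ⟪ basis L ∣ φ ⟫ ≈ ⟦ sum (map g L) ⟧
  ⟪⟫-basis []      g φ≈g = refl
  ⟪⟫-basis (x ∷ L) g φ≈g = trans (+-cong (trans (*-identityˡ _) (φ≈g x)) (⟪⟫-basis L g φ≈g)) (sym (⟦+⟧ (g x) _))

  ⟪filter-allSub⟫ : ∀ {n} (p : Sub n → Bool) y →
    ⟪ basis (filter (λ z → T? (p z)) (allSub n)) ∣ ⟦δ⟧ y ⟫ ≈ ⟦ [ p y ] ⟧
  ⟪filter-allSub⟫ {n} p y =
    trans (⟪⟫-basis (filter (λ z → T? (p z)) (allSub n)) (λ z → δ z y) (λ _ → refl))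
          (⟦≡⟧ (multiplicity-filter-allSub p y))

  ⟪filter-allSub⟫² : ∀ {n} (p : Sub n → Bool) (q : Sub n → Sub n → Bool) y →
    ⟪ basis (filter (λ z → T? (p z)) (allSub n)) ∣ (λ z → ⟪ basis (filter (λ w → T? (q z w)) (allSub n)) ∣ ⟦δ⟧ y ⟫) ⟫
      ≈ ⟦ count (λ z → p z ∧ q z y) ⟧
  ⟪filter-allSub⟫² {n} p q y =
    trans (⟪⟫-basis (filter (λ z → T? (p z)) (allSub n)) (λ z → [ q z y ]) (λ z → ⟪filter-allSub⟫ (q z) y))
          (⟦≡⟧ (count-filter-allSub p (λ z → q z y)))

  ν-on-basis : ∀ {n} (x y : Sub n) →
    ⟪ ε (weight x) x ∣ (λ z → ⟪ ∂ (suc (weight x)) z ∣ ⟦δ⟧ y ⟫) ⟫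
      - ⟪ ∂ (weight x) x ∣ (λ z → ⟪ ε (weight x ℕ.∸ 1) z ∣ ⟦δ⟧ y ⟫) ⟫
    ≈ (⟦ 2 ℕ.* n ⟧ - ⟦ 3 ℕ.* weight x ⟧) * ⟦δ⟧ y x - ⟪ σ x ∣ ⟦δ⟧ y ⟫
  ν-on-basis {n} x y = begin
    _                                   ≈⟨ +-cong (⟪filter-allSub⟫² _ _ y) (-‿cong (⟪filter-allSub⟫² _ _ y)) ⟩
    ⟦ ν⁺-count x y ⟧ - ⟦ ν⁻-count x y ⟧ ≈⟨ transpose balance ⟩
    d * u - (d * t + f)                 ≈⟨ +-congˡ (sym (⁻¹-∙-comm _ _)) ⟩
    d * u + (- (d * t) - f)             ≈⟨ sym (+-assoc _ _ _) ⟩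
    (d * u - d * t) - f                 ≈⟨ +-congʳ (trans (sym (*-distribˡ-minus d u t)) (*-comm d _)) ⟩
    (u - t) * d - f                     ≈⟨ +-congˡ (-‿cong (sym (⟪⟫-basis (flips x) (λ z → δ z y) (λ _ → refl)))) ⟩
    (u - t) * d - ⟪ σ x ∣ ⟦δ⟧ y ⟫       ∎
    where
    d = ⟦ δ x y ⟧
    t = ⟦ 3 ℕ.* weight x ⟧
    u = ⟦ 2 ℕ.* n ⟧
    f = ⟦ multiplicity y (flips x) ⟧
    S = ν⁺-count x y
    D = ν⁻-count x y
    balance : ⟦ S ⟧ + (d * t + f) ≈ ⟦ D ⟧ + d * u
    balance = begin
      ⟦ S ⟧ + (d * t + f)                                          ≈⟨ +-congˡ (+-congʳ (sym (⟦*⟧ (δ x y) _))) ⟩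
      ⟦ S ⟧ + (⟦ δ x y ℕ.* (3 ℕ.* weight x) ⟧ + f)                 ≈⟨ sym (+-assoc _ _ _) ⟩
      ⟦ S ⟧ + ⟦ δ x y ℕ.* (3 ℕ.* weight x) ⟧ + f                   ≈⟨ +-congʳ (sym (⟦+⟧ S _)) ⟩
      ⟦ S ℕ.+ δ x y ℕ.* (3 ℕ.* weight x) ⟧ + f                     ≈⟨ sym (⟦+⟧ (S ℕ.+ δ x y ℕ.* (3 ℕ.* weight x)) _) ⟩
      ⟦ S ℕ.+ δ x y ℕ.* (3 ℕ.* weight x) ℕ.+ multiplicity y (flips x) ⟧ ≈⟨ ⟦≡⟧ (ν-counts-balanced x y) ⟩
      ⟦ D ℕ.+ δ x y ℕ.* (2 ℕ.* n) ⟧                                ≈⟨ ⟦+⟧ D _ ⟩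
      ⟦ D ⟧ + ⟦ δ x y ℕ.* (2 ℕ.* n) ⟧                              ≈⟨ +-congˡ (⟦*⟧ (δ x y) (2 ℕ.* n)) ⟩
      ⟦ D ⟧ + d * u                                                ∎

lemma2p6 : ∀ {c ℓ} (F : Field c ℓ) (n k : ℕ) → k ≤ n →
    let open Field F
        open Maps F
    in ∀ (v : Comb n) → InM n k v →
       (ν⁺ k v ⊖ ν⁻ k v) ≋ (scale (⟦ 2 ℕ.* n ⟧ - ⟦ 3 ℕ.* k ⟧) v ⊖ lin σ v)
lemma2p6 F n k _ v v∈M y = begin
  coeff (ν⁺ k v ⊖ ν⁻ k v) y                   ≈⟨ coeff≈⟪⟦δ⟧⟫ (ν⁺ k v ⊖ ν⁻ k v) y ⟩
  ⟪ ν⁺ k v ⊖ ν⁻ k v ∣ δʸ ⟫                    ≈⟨ ⟪⟫-⊖ (ν⁺ k v) (ν⁻ k v) δʸ ⟩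
  ⟪ ν⁺ k v ∣ δʸ ⟫ - ⟪ ν⁻ k v ∣ δʸ ⟫           ≈⟨ +-cong (⟪⟫-lin² (∂ (ℕ.suc k)) (ε k) v δʸ)
                                                       (-‿cong (⟪⟫-lin² (ε (k ℕ.∸ 1)) (∂ k) v δʸ)) ⟩
  ⟪ v ∣ P ⟫ - ⟪ v ∣ M ⟫                       ≈⟨ sym (⟪⟫-minus v P M) ⟩
  ⟪ v ∣ (λ x → P x - M x) ⟫                   ≈⟨ ⟪⟫-cong-InM v∈M (λ { x ≡.refl → ν-on-basis x y }) ⟩
  ⟪ v ∣ (λ x → c * δʸ x - S x) ⟫              ≈⟨ ⟪⟫-minus v _ S ⟩
  ⟪ v ∣ (λ x → c * δʸ x) ⟫ - ⟪ v ∣ S ⟫        ≈⟨ +-cong (trans (⟪⟫-*ˡ c v δʸ) (sym (⟪⟫-scale c v δʸ)))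
                                                       (-‿cong (sym (⟪⟫-lin σ v δʸ))) ⟩
  ⟪ scale c v ∣ δʸ ⟫ - ⟪ lin σ v ∣ δʸ ⟫       ≈⟨ sym (⟪⟫-⊖ (scale c v) (lin σ v) δʸ) ⟩
  ⟪ scale c v ⊖ lin σ v ∣ δʸ ⟫                ≈⟨ sym (coeff≈⟪⟦δ⟧⟫ (scale c v ⊖ lin σ v) y) ⟩
  coeff (scale c v ⊖ lin σ v) y               ∎
  where
  open Field F
  open Maps F
  open Coefficients F
  open import Relation.Binary.Reasoning.Setoid setoid
  δʸ = ⟦δ⟧ y
  c = ⟦ 2 ℕ.* n ⟧ - ⟦ 3 ℕ.* k ⟧
  P = λ x → ⟪ ε k x ∣ (λ z → ⟪ ∂ (ℕ.suc k) z ∣ δʸ ⟫) ⟫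
  M = λ x → ⟪ ∂ k x ∣ (λ z → ⟪ ε (k ℕ.∸ 1) z ∣ δʸ ⟫) ⟫
  S = λ x → ⟪ σ x ∣ δʸ ⟫
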